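{- Let $a,b,c$ be commuting indeterminates and let $D$ be the derivation of the polynomial ring $\mathbb{Q}[a,b,c]$ (a linear map satisfying $D(uv)=D(u)v+uD(v)$) determined by $D(a)=ab$, $D(b)=b^2c$, $D(c)=bc^2$. For $n\ge 0$ let $y_n(x)=\sum_{k=0}^n\frac{(n+k)!}{(n-k)!\,k!}\left(\frac{x}{2}\right)^k$ be the Bessel polynomials. Then for all $n\geq 0$, $$D^n(ab)=ab^{n+1}y_n(c).$$
   Context: This is the formal derivative associated with the context-free grammar $G=\{a\rightarrow ab,\ b\rightarrow b^2c,\ c\rightarrow bc^2\}$: $D$ replaces each letter by its image under the grammar and extends to products by the Leibniz rule. $D^0$ is the identity. -}

module Defs where

open import Data.Nat as ℕ using (ℕ; zero; suc; _∸_; _!)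
open import Data.Nat.Properties using (m*n≢0; m^n≢0; _!*_!≢0)
open import Data.Integer using (+_)
open import Data.Rational as ℚ using (ℚ; 0ℚ; 1ℚ)
open import Data.Product using (_×_; _,_)
open import Data.List using (List; []; _∷_; _++_; map; concatMap; foldr; upTo)
open import Relation.Nullary using (yes; no)
open import Relation.Binary.PropositionalEquality using (_≡_)

-- Polynomials in ℚ[a,b,c], represented as finite formal sums of terms
-- q · a^i b^j c^k.  Two polynomials are equal iff all their
-- coefficients agree (see _≈P_ below).

Mono : Set
Mono = ℕ × ℕ × ℕ          -- exponents (i , j , k) of a^i b^j c^k

Poly : Set
Poly = List (ℚ × Mono)

coeff : Poly → ℕ → ℕ → ℕ → ℚ
coeff [] i j k = 0ℚ
coeff ((q , (i' , j' , k')) ∷ p) i j k with i' ℕ.≟ i | j' ℕ.≟ j | k' ℕ.≟ k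
... | yes _ | yes _ | yes _ = q ℚ.+ coeff p i j k
... | _     | _     | _     = coeff p i j k

infix 4 _≈P_
_≈P_ : Poly → Poly → Set
p ≈P q = ∀ i j k → coeff p i j k ≡ coeff q i j k

0P : Poly
0P = []

const : ℚ → Poly
const q = (q , (0 , 0 , 0)) ∷ []

mono : ℕ → ℕ → ℕ → Poly
mono i j k = (1ℚ , (i , j , k)) ∷ []

A B C : Poly
A = mono 1 0 0
B = mono 0 1 0
C = mono 0 0 1

infixl 6 _+P_
infixl 7 _*P_

_+P_ : Poly → Poly → Poly
_+P_ = _++_

scale : ℚ → Poly → Poly
scale q = map λ { (r , m) → (q ℚ.* r , m) }

mulTerm : ℚ × Mono → ℚ × Mono → ℚ × Mono
mulTerm (q , (i , j , k)) (r , (i' , j' , k')) =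
  (q ℚ.* r , (i ℕ.+ i' , j ℕ.+ j' , k ℕ.+ k'))

_*P_ : Poly → Poly → Poly
p *P q = concatMap (λ t → map (mulTerm t) q) p

_^P_ : Poly → ℕ → Poly
p ^P zero  = const 1ℚ
p ^P suc n = p *P (p ^P n)

-- On monomials it is computed by the Leibniz rule, peeling off one
-- variable at a time:  D(x·m) = D(x)·m + x·D(m),  D(1) = 0;
-- it is then extended linearly.

Da Db Dc : Poly
Da = A *P B
Db = B *P B *P C
Dc = B *P C *P C

Dmono : ℕ → ℕ → ℕ → Poly
Dmono (suc i) j k = Da *P mono i j k +P A *P Dmono i j k
Dmono zero (suc j) k = Db *P mono zero j k +P B *P Dmono zero j k
Dmono zero zero (suc k) = Dc *P mono zero zero k +P C *P Dmono zero zero k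
Dmono zero zero zero = 0P

D : Poly → Poly
D = concatMap λ { (q , (i , j , k)) → scale q (Dmono i j k) }

D^ : ℕ → Poly → Poly
D^ zero    p = p
D^ (suc n) p = D (D^ n p)

-- Bessel polynomials  y_n(x) = Σ_{k=0}^n (n+k)! / ((n-k)! k!) (x/2)^k,
-- here with x := c.  The coefficient of c^k is (n+k)!/((n-k)! k! 2^k).

besselCoeff : ℕ → ℕ → ℚ
besselCoeff n k =
  ((+ ((n ℕ.+ k) !)) ℚ./ ((n ∸ k) ! ℕ.* k ! ℕ.* 2 ℕ.^ k))
    {{m*n≢0 _ _ {{(n ∸ k) !* k !≢0}} {{m^n≢0 2 k}}}}

bessel-c : ℕ → Poly
bessel-c n = concatMap (λ k → scale (besselCoeff n k) (mono 0 0 k)) (upTo (suc n))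

module Submission where

-- Every term of D^n(ab) has the shape q·a·b^(n+1)·c^k, because
-- D(a b^J c^k) = a b^(J+1) c^k + (J+k)·a b^(J+1) c^(k+1).  Polynomials of
-- this shape ("pure of degree J") are determined by their c-coefficients,
-- and D acts on those by the recurrence
--     [c^0] D p = [c^0] p,     [c^(k+1)] D p = [c^(k+1)] p + (J+k)·[c^k] p.
-- So the c-coefficients of D^n(ab) are the integers bessel n k defined by
-- this recurrence, and the factorial identity
--     bessel n k · (n-k)! k! 2^k = (n+k)!
-- identifies them with the coefficients of the Bessel polynomial y_n.

open import Defs
open import Data.Nat using (ℕ; suc)

open import Data.Nat as ℕ using (zero; _!; _≤_; _<_; s≤s)
import Data.Nat.Properties as ℕP
open import Data.Nat.Tactic.RingSolver using (solve-∀)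
open import Data.Integer as ℤ using () renaming (+_ to pos)
import Data.Integer.Properties as ℤP
open import Data.Rational as ℚ using (ℚ; mkℚ; 0ℚ; 1ℚ; _+_; _*_)
import Data.Rational.Properties as ℚP
import Data.Rational.Unnormalised as ℚᵘ
open import Data.Nat.Coprimality using (1-coprimeTo) renaming (sym to coprime-sym)
open import Algebra.Properties.CommutativeMonoid.Mult ℚP.+-0-commutativeMonoid
  using (×-assocˡ; ×-distrib-+) renaming (_×_ to _·_)
open import Algebra.Bundles using (CommutativeMonoid)
open import Algebra.Properties.CommutativeSemigroup
  (CommutativeMonoid.commutativeSemigroup ℚP.+-0-commutativeMonoid) using (interchange)
open import Data.Empty using (⊥-elim)
open import Function using (_∘_)
open import Data.Product using (_×_; _,_; proj₁; proj₂)
open import Data.Sum using (inj₁; inj₂)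
open import Data.List using (List; []; _∷_; _++_; map; concatMap; replicate; upTo)
import Data.List.Properties as ListP
open import Data.List.Relation.Unary.All using (All; []; _∷_)
open import Data.List.Relation.Unary.All.Properties using (++⁺; replicate⁺)
open import Relation.Nullary using (yes; no; ¬_)
open import Relation.Binary.PropositionalEquality
open ≡-Reasoning

fromℕ : ℕ → ℚ
fromℕ a = pos a ℚ./ 1

-- fromℕ a is already in lowest terms, so sums of such numbers compute.
fromℕ-mkℚ : ∀ a → fromℕ a ≡ mkℚ (pos a) 0 (coprime-sym (1-coprimeTo a))
fromℕ-mkℚ a = ℚP.normalize-coprime (coprime-sym (1-coprimeTo a))

fromℕ-+ : ∀ a b → fromℕ (a ℕ.+ b) ≡ fromℕ a + fromℕ b
fromℕ-+ a b = begin
  pos (a ℕ.+ b) ℚ./ 1                                ≡⟨ ℚP./-cong numerators refl ⟩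
  (pos a ℤ.* pos 1 ℤ.+ pos b ℤ.* pos 1) ℚ./ (1 ℕ.* 1) ≡⟨⟩
  mkℚ (pos a) 0 (coprime-sym (1-coprimeTo a)) + mkℚ (pos b) 0 (coprime-sym (1-coprimeTo b))
                                                     ≡⟨ sym (cong₂ _+_ (fromℕ-mkℚ a) (fromℕ-mkℚ b)) ⟩
  fromℕ a + fromℕ b                                  ∎
  where
  numerators : pos (a ℕ.+ b) ≡ pos a ℤ.* pos 1 ℤ.+ pos b ℤ.* pos 1
  numerators = trans (ℤP.pos-+ a b)
    (sym (cong₂ ℤ._+_ (ℤP.*-identityʳ (pos a)) (ℤP.*-identityʳ (pos b))))

·-fromℕ : ∀ m b → m · fromℕ b ≡ fromℕ (m ℕ.* b)
·-fromℕ zero    b = refl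
·-fromℕ (suc m) b = trans (cong (fromℕ b +_) (·-fromℕ m b)) (sym (fromℕ-+ b (m ℕ.* b)))

fromℕ-/ : ∀ b d .{{_ : ℕ.NonZero d}} → pos (b ℕ.* d) ℚ./ d ≡ fromℕ b
fromℕ-/ b (suc d) =
  ℚP.fromℚᵘ-cong {ℚᵘ.mkℚᵘ (pos (b ℕ.* suc d)) d} {ℚᵘ.mkℚᵘ (pos b) 0}
    (ℚᵘ.*≡* (trans (ℤP.*-identityʳ (pos (b ℕ.* suc d))) (ℤP.pos-* b (suc d))))

·-zeroʳ : ∀ m → m · 0ℚ ≡ 0ℚ
·-zeroʳ m = trans (×-assocˡ 0ℚ m 0) (cong (_· 0ℚ) (ℕP.*-zeroʳ m))

-- δ k′ k q is q if k′ = k and 0 otherwise (by recursion, so that it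
-- computes on numerals and on suc).
δ : ℕ → ℕ → ℚ → ℚ
δ zero    zero    q = q
δ zero    (suc _) q = 0ℚ
δ (suc _) zero    q = 0ℚ
δ (suc k′) (suc k) q = δ k′ k q

δ-refl : ∀ k q → δ k k q ≡ q
δ-refl zero    q = refl
δ-refl (suc k) q = δ-refl k q

δ-≢ : ∀ k′ k q → ¬ k′ ≡ k → δ k′ k q ≡ 0ℚ
δ-≢ zero     zero    q k′≢k = ⊥-elim (k′≢k refl)
δ-≢ zero     (suc k) q k′≢k = refl
δ-≢ (suc k′) zero    q k′≢k = refl
δ-≢ (suc k′) (suc k) q k′≢k = δ-≢ k′ k q (λ e → k′≢k (cong suc e))

δ-* : ∀ k′ k x y → δ k′ k (x * y) ≡ x * δ k′ k y
δ-* zero     zero    x y = refl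
δ-* zero     (suc k) x y = sym (ℚP.*-zeroʳ x)
δ-* (suc k′) zero    x y = sym (ℚP.*-zeroʳ x)
δ-* (suc k′) (suc k) x y = δ-* k′ k x y

·-δ : ∀ (f : ℕ → ℕ) k′ k q → f k′ · δ k′ k q ≡ f k · δ k′ k q
·-δ f k′ k q with k′ ℕ.≟ k
... | yes refl = refl
... | no k′≢k rewrite δ-≢ k′ k q k′≢k = trans (·-zeroʳ (f k′)) (sym (·-zeroʳ (f k)))

cCoeff : Poly → ℕ → ℚ
cCoeff []                        k = 0ℚ
cCoeff ((q , (_ , _ , k′)) ∷ p) k = δ k′ k q + cCoeff p k

cCoeff-++ : ∀ p r k → cCoeff (p ++ r) k ≡ cCoeff p k + cCoeff r k
cCoeff-++ []                         r k = sym (ℚP.+-identityˡ _)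
cCoeff-++ ((q , (_ , _ , k′)) ∷ p) r k =
  trans (cong (δ k′ k q +_) (cCoeff-++ p r k)) (sym (ℚP.+-assoc (δ k′ k q) _ _))

cCoeff-replicate : ∀ m q i j k′ k → cCoeff (replicate m (q , (i , j , k′))) k ≡ m · δ k′ k q
cCoeff-replicate zero    q i j k′ k = refl
cCoeff-replicate (suc m) q i j k′ k = cong (δ k′ k q +_) (cCoeff-replicate m q i j k′ k)

cCoeff-mulTerm : ∀ q i j p k → cCoeff (map (mulTerm (q , (i , j , 0))) p) k ≡ q * cCoeff p k
cCoeff-mulTerm q i j []                         k = sym (ℚP.*-zeroʳ q)
cCoeff-mulTerm q i j ((r , (_ , _ , k′)) ∷ p) k = begin
  δ k′ k (q * r) + cCoeff (map (mulTerm (q , (i , j , 0))) p) k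
    ≡⟨ cong₂ _+_ (δ-* k′ k q r) (cCoeff-mulTerm q i j p k) ⟩
  q * δ k′ k r + q * cCoeff p k ≡⟨ sym (ℚP.*-distribˡ-+ q _ _) ⟩
  q * (δ k′ k r + cCoeff p k)   ∎

PureTerm : ℕ → ℚ × Mono → Set
PureTerm J (q , (i , j , k)) = i ≡ 1 × j ≡ J

Pure : ℕ → Poly → Set
Pure J = All (PureTerm J)

pure-coeff-on : ∀ {J} p → Pure J p → ∀ k → coeff p 1 J k ≡ cCoeff p k
pure-coeff-on []                             []                   k = refl
pure-coeff-on {J} ((q , (.1 , .J , k′)) ∷ p) ((refl , refl) ∷ pp) k
  with J ℕ.≟ J | k′ ℕ.≟ k
... | no J≢J  | _         = ⊥-elim (J≢J refl)
... | yes _   | yes refl  = cong₂ _+_ (sym (δ-refl k′ q)) (pure-coeff-on p pp k)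
... | yes _   | no k′≢k   = trans (pure-coeff-on p pp k)
  (sym (trans (cong (_+ cCoeff p k) (δ-≢ k′ k q k′≢k)) (ℚP.+-identityˡ _)))

pure-coeff-off : ∀ {J} p → Pure J p → ∀ {i j} → ¬ (i ≡ 1 × j ≡ J) → ∀ k → coeff p i j k ≡ 0ℚ
pure-coeff-off []                             []                   off k = refl
pure-coeff-off {J} ((q , (.1 , .J , k′)) ∷ p) ((refl , refl) ∷ pp) {i} {j} off k
  with 1 ℕ.≟ i | J ℕ.≟ j | k′ ℕ.≟ k
... | yes refl | yes refl | _ = ⊥-elim (off (refl , refl))
... | yes _    | no _     | _ = pure-coeff-off p pp off k
... | no _     | _        | _ = pure-coeff-off p pp off k

pure-≈P : ∀ {J p r} → Pure J p → Pure J r → (∀ k → cCoeff p k ≡ cCoeff r k) → p ≈P r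
pure-≈P {J} {p} {r} pp pr same i j k with i ℕ.≟ 1 | j ℕ.≟ J
... | yes refl | yes refl =
  trans (pure-coeff-on p pp k) (trans (same k) (sym (pure-coeff-on r pr k)))
... | no i≢1 | _ =
  trans (pure-coeff-off p pp (i≢1 ∘ proj₁) k) (sym (pure-coeff-off r pr (i≢1 ∘ proj₁) k))
... | _ | no j≢J =
  trans (pure-coeff-off p pp (j≢J ∘ proj₂) k) (sym (pure-coeff-off r pr (j≢J ∘ proj₂) k))

-- Multiplying m equal terms by a term t (as _*P_ does, with its trailing ++ [])
-- gives m equal terms.
mulTerm-replicate : ∀ t m u → map (mulTerm t) (replicate m u) ++ [] ≡ replicate m (mulTerm t u)
mulTerm-replicate t m u = trans (ListP.++-identityʳ _) (ListP.map-replicate (mulTerm t) m u)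

Dmono-bc : ∀ j k → Dmono 0 j k ≡ replicate (j ℕ.+ k) (1ℚ , (0 , suc j , suc k))
Dmono-bc zero    zero    = refl
Dmono-bc zero    (suc k) = cong ((1ℚ , (0 , 1 , suc (suc k))) ∷_)
  (trans (cong (λ p → map (mulTerm (1ℚ , (0 , 0 , 1))) p ++ []) (Dmono-bc zero k))
         (mulTerm-replicate _ k _))
Dmono-bc (suc j) k       = cong ((1ℚ , (0 , suc (suc j) , suc k)) ∷_)
  (trans (cong (λ p → map (mulTerm (1ℚ , (0 , 1 , 0))) p ++ []) (Dmono-bc j k))
         (mulTerm-replicate _ (j ℕ.+ k) _))

Dmono-abc : ∀ j k →
  Dmono 1 j k ≡ (1ℚ , (1 , suc j , k)) ∷ replicate (j ℕ.+ k) (1ℚ , (1 , suc j , suc k))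
Dmono-abc j k = cong ((1ℚ , (1 , suc j , k)) ∷_)
  (trans (cong (λ p → map (mulTerm (1ℚ , (1 , 0 , 0))) p ++ []) (Dmono-bc j k))
         (mulTerm-replicate _ (j ℕ.+ k) _))

D-pure-term : ∀ q J k p → D ((q , (1 , J , k)) ∷ p) ≡
  (q , (1 , suc J , k)) ∷ replicate (J ℕ.+ k) (q , (1 , suc J , suc k)) ++ D p
D-pure-term q J k p = cong (_++ D p) (begin
  scale q (Dmono 1 J k)
    ≡⟨ cong (scale q) (Dmono-abc J k) ⟩
  (q * 1ℚ , (1 , suc J , k)) ∷ scale q (replicate (J ℕ.+ k) (1ℚ , (1 , suc J , suc k)))
    ≡⟨ cong ((q * 1ℚ , (1 , suc J , k)) ∷_) (ListP.map-replicate _ (J ℕ.+ k) _) ⟩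
  (q * 1ℚ , (1 , suc J , k)) ∷ replicate (J ℕ.+ k) (q * 1ℚ , (1 , suc J , suc k))
    ≡⟨ cong (λ r → (r , (1 , suc J , k)) ∷ replicate (J ℕ.+ k) (r , (1 , suc J , suc k)))
            (ℚP.*-identityʳ q) ⟩
  (q , (1 , suc J , k)) ∷ replicate (J ℕ.+ k) (q , (1 , suc J , suc k)) ∎)

pure-D : ∀ {J} p → Pure J p → Pure (suc J) (D p)
pure-D []                             []                   = []
pure-D {J} ((q , (.1 , .J , k)) ∷ p) ((refl , refl) ∷ pp) rewrite D-pure-term q J k p =
  (refl , refl) ∷ ++⁺ (replicate⁺ (J ℕ.+ k) (refl , refl)) (pure-D p pp)

cCoeff-D-zero : ∀ {J} p → Pure J p → cCoeff (D p) 0 ≡ cCoeff p 0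
cCoeff-D-zero []                             []                   = refl
cCoeff-D-zero {J} ((q , (.1 , .J , k)) ∷ p) ((refl , refl) ∷ pp) = begin
  cCoeff (D ((q , (1 , J , k)) ∷ p)) 0
    ≡⟨ cong (λ r → cCoeff r 0) (D-pure-term q J k p) ⟩
  δ k 0 q + cCoeff (replicate (J ℕ.+ k) (q , (1 , suc J , suc k)) ++ D p) 0
    ≡⟨ cong (δ k 0 q +_) (cCoeff-++ (replicate (J ℕ.+ k) (q , (1 , suc J , suc k))) (D p) 0) ⟩
  δ k 0 q + (cCoeff (replicate (J ℕ.+ k) (q , (1 , suc J , suc k))) 0 + cCoeff (D p) 0)
    ≡⟨ cong₂ (λ x y → δ k 0 q + (x + y))
             (trans (cCoeff-replicate (J ℕ.+ k) q 1 (suc J) (suc k) 0) (·-zeroʳ (J ℕ.+ k)))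
             (cCoeff-D-zero p pp) ⟩
  δ k 0 q + (0ℚ + cCoeff p 0)
    ≡⟨ cong (δ k 0 q +_) (ℚP.+-identityˡ (cCoeff p 0)) ⟩
  δ k 0 q + cCoeff p 0 ∎

cCoeff-D-suc : ∀ {J} p → Pure J p → ∀ k →
  cCoeff (D p) (suc k) ≡ cCoeff p (suc k) + (J ℕ.+ k) · cCoeff p k
cCoeff-D-suc {J} [] [] k = sym (trans (ℚP.+-identityˡ _) (·-zeroʳ (J ℕ.+ k)))
cCoeff-D-suc {J} ((q , (.1 , .J , k′)) ∷ p) ((refl , refl) ∷ pp) k = begin
  cCoeff (D ((q , (1 , J , k′)) ∷ p)) (suc k)
    ≡⟨ cong (λ r → cCoeff r (suc k)) (D-pure-term q J k′ p) ⟩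
  δ k′ (suc k) q + cCoeff (replicate (J ℕ.+ k′) (q , (1 , suc J , suc k′)) ++ D p) (suc k)
    ≡⟨ cong (δ k′ (suc k) q +_) (cCoeff-++ (replicate (J ℕ.+ k′) (q , (1 , suc J , suc k′))) (D p) (suc k)) ⟩
  δ k′ (suc k) q + (cCoeff (replicate (J ℕ.+ k′) (q , (1 , suc J , suc k′))) (suc k) + cCoeff (D p) (suc k))
    ≡⟨ cong₂ (λ x y → δ k′ (suc k) q + (x + y))
             (trans (cCoeff-replicate (J ℕ.+ k′) q 1 (suc J) (suc k′) (suc k)) (·-δ (J ℕ.+_) k′ k q))
             (cCoeff-D-suc p pp k) ⟩
  δ k′ (suc k) q + ((J ℕ.+ k) · δ k′ k q + (cCoeff p (suc k) + (J ℕ.+ k) · cCoeff p k))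
    ≡⟨ sym (ℚP.+-assoc (δ k′ (suc k) q) _ _) ⟩
  (δ k′ (suc k) q + (J ℕ.+ k) · δ k′ k q) + (cCoeff p (suc k) + (J ℕ.+ k) · cCoeff p k)
    ≡⟨ interchange (δ k′ (suc k) q) _ (cCoeff p (suc k)) _ ⟩
  (δ k′ (suc k) q + cCoeff p (suc k)) + ((J ℕ.+ k) · δ k′ k q + (J ℕ.+ k) · cCoeff p k)
    ≡⟨ cong ((δ k′ (suc k) q + cCoeff p (suc k)) +_) (sym (×-distrib-+ (δ k′ k q) (cCoeff p k) (J ℕ.+ k))) ⟩
  (δ k′ (suc k) q + cCoeff p (suc k)) + (J ℕ.+ k) · (δ k′ k q + cCoeff p k) ∎

-- The recurrence that D induces on c-coefficients, started from ab.
bessel : ℕ → ℕ → ℕ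
bessel n       zero    = 1
bessel zero    (suc k) = 0
bessel (suc n) (suc k) = bessel n (suc k) ℕ.+ (suc n ℕ.+ k) ℕ.* bessel n k

bessel-vanishes : ∀ {n k} → n < k → bessel n k ≡ 0
bessel-vanishes {zero}  {suc k} _ = refl
bessel-vanishes {suc n} {suc k} (s≤s n<k)
  rewrite bessel-vanishes (ℕP.m<n⇒m<1+n n<k) | bessel-vanishes n<k = ℕP.*-zeroʳ (suc n ℕ.+ k)

-- bessel n k · (n-k)! k! 2^k = (n+k)!, written with n = k + d; by
-- lexicographic induction on (k, d).
bessel-factorial : ∀ k d → bessel (k ℕ.+ d) k ℕ.* (d ! ℕ.* k ! ℕ.* 2 ℕ.^ k) ≡ (k ℕ.+ d ℕ.+ k) !
bessel-factorial zero d = begin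
  1 ℕ.* (d ! ℕ.* 1 ℕ.* 1) ≡⟨ ℕP.*-identityˡ _ ⟩
  d ! ℕ.* 1 ℕ.* 1         ≡⟨ trans (ℕP.*-identityʳ _) (ℕP.*-identityʳ _) ⟩
  d !                     ≡⟨ cong _! (sym (ℕP.+-identityʳ d)) ⟩
  (d ℕ.+ 0) !             ∎
-- For k+1 and d = 0 the first summand of the recurrence vanishes, and with
-- c = 2k+1 we get c·2(k+1)·(2k)! = (c+1)·c!.
bessel-factorial (suc k) zero = begin
  (bessel (k ℕ.+ 0) (suc k) ℕ.+ c ℕ.* β₀) ℕ.* (1 ℕ.* (suc k ℕ.* k !) ℕ.* (2 ℕ.* 2 ℕ.^ k))
    ≡⟨ cong (λ x → (x ℕ.+ c ℕ.* β₀) ℕ.* (1 ℕ.* (suc k ℕ.* k !) ℕ.* (2 ℕ.* 2 ℕ.^ k)))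
            (bessel-vanishes (s≤s (ℕP.≤-reflexive (ℕP.+-identityʳ k)))) ⟩
  (0 ℕ.+ c ℕ.* β₀) ℕ.* (1 ℕ.* (suc k ℕ.* k !) ℕ.* (2 ℕ.* 2 ℕ.^ k))
    ≡⟨ expand k β₀ (k !) (2 ℕ.^ k) ⟩
  c ℕ.* (2 ℕ.* suc k) ℕ.* (β₀ ℕ.* (1 ℕ.* k ! ℕ.* 2 ℕ.^ k))
    ≡⟨ cong (c ℕ.* (2 ℕ.* suc k) ℕ.*_) (bessel-factorial k zero) ⟩
  c ℕ.* (2 ℕ.* suc k) ℕ.* (k ℕ.+ 0 ℕ.+ k) !
    ≡⟨ collect k ((k ℕ.+ 0 ℕ.+ k) !) ⟩
  suc c ℕ.* c !
    ≡⟨ cong (λ m → suc m ℕ.* m !) (index k) ⟩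
  (suc k ℕ.+ 0 ℕ.+ suc k) ! ∎
  where
  β₀ c : ℕ
  β₀ = bessel (k ℕ.+ 0) k
  c = suc (k ℕ.+ 0) ℕ.+ k
  expand : ∀ k y f h → (0 ℕ.+ (suc (k ℕ.+ 0) ℕ.+ k) ℕ.* y) ℕ.* (1 ℕ.* (suc k ℕ.* f) ℕ.* (2 ℕ.* h))
                     ≡ (suc (k ℕ.+ 0) ℕ.+ k) ℕ.* (2 ℕ.* suc k) ℕ.* (y ℕ.* (1 ℕ.* f ℕ.* h))
  expand = solve-∀
  collect : ∀ k y → (suc (k ℕ.+ 0) ℕ.+ k) ℕ.* (2 ℕ.* suc k) ℕ.* y
                  ≡ suc (suc (k ℕ.+ 0) ℕ.+ k) ℕ.* ((suc (k ℕ.+ 0) ℕ.+ k) ℕ.* y)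
  collect = solve-∀
  index : ∀ k → suc (k ℕ.+ 0) ℕ.+ k ≡ k ℕ.+ 0 ℕ.+ suc k
  index = solve-∀
-- For k+1 and d+1, with c = 2k+d+2, the two summands of the recurrence
-- contribute (d+1)·c! and c·2(k+1)·(c-1)!, together (c+1)·c!.
bessel-factorial (suc k) (suc d) = begin
  (β₁ ℕ.+ c ℕ.* β₀) ℕ.* ((suc d ℕ.* d !) ℕ.* (suc k ℕ.* k !) ℕ.* (2 ℕ.* 2 ℕ.^ k))
    ≡⟨ expand d k β₁ β₀ (d !) (k !) (2 ℕ.^ k) ⟩
  suc d ℕ.* (β₁ ℕ.* (d ! ℕ.* (suc k ℕ.* k !) ℕ.* (2 ℕ.* 2 ℕ.^ k)))
    ℕ.+ c ℕ.* (2 ℕ.* suc k) ℕ.* (β₀ ℕ.* ((suc d ℕ.* d !) ℕ.* k ! ℕ.* 2 ℕ.^ k))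
    ≡⟨ cong₂ (λ x y → suc d ℕ.* x ℕ.+ c ℕ.* (2 ℕ.* suc k) ℕ.* y) shorter-d (bessel-factorial k (suc d)) ⟩
  suc d ℕ.* c ! ℕ.+ c ℕ.* (2 ℕ.* suc k) ℕ.* (k ℕ.+ suc d ℕ.+ k) !
    ≡⟨ collect d k ((k ℕ.+ suc d ℕ.+ k) !) ⟩
  suc c ℕ.* c !
    ≡⟨ cong (λ m → suc m ℕ.* m !) (index₂ k d) ⟩
  (suc k ℕ.+ suc d ℕ.+ suc k) ! ∎
  where
  β₁ β₀ c : ℕ
  β₁ = bessel (k ℕ.+ suc d) (suc k)
  β₀ = bessel (k ℕ.+ suc d) k
  c = suc (k ℕ.+ suc d) ℕ.+ k
  index₁ : ∀ k d → suc k ℕ.+ d ℕ.+ suc k ≡ suc (k ℕ.+ suc d) ℕ.+ k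
  index₁ = solve-∀
  index₂ : ∀ k d → suc (k ℕ.+ suc d) ℕ.+ k ≡ k ℕ.+ suc d ℕ.+ suc k
  index₂ = solve-∀
  -- the induction hypothesis at (k+1, d), with its indices rewritten
  shorter-d : β₁ ℕ.* (d ! ℕ.* (suc k ℕ.* k !) ℕ.* (2 ℕ.* 2 ℕ.^ k)) ≡ c !
  shorter-d = begin
    β₁ ℕ.* (d ! ℕ.* (suc k ℕ.* k !) ℕ.* (2 ℕ.* 2 ℕ.^ k))
      ≡⟨ cong (λ m → bessel m (suc k) ℕ.* (d ! ℕ.* (suc k ℕ.* k !) ℕ.* (2 ℕ.* 2 ℕ.^ k))) (ℕP.+-suc k d) ⟩
    bessel (suc k ℕ.+ d) (suc k) ℕ.* (d ! ℕ.* (suc k) ! ℕ.* 2 ℕ.^ suc k)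
      ≡⟨ bessel-factorial (suc k) d ⟩
    (suc k ℕ.+ d ℕ.+ suc k) !
      ≡⟨ cong _! (index₁ k d) ⟩
    c ! ∎
  expand : ∀ d k x y f g h →
    (x ℕ.+ (suc (k ℕ.+ suc d) ℕ.+ k) ℕ.* y) ℕ.* ((suc d ℕ.* f) ℕ.* (suc k ℕ.* g) ℕ.* (2 ℕ.* h))
    ≡ suc d ℕ.* (x ℕ.* (f ℕ.* (suc k ℕ.* g) ℕ.* (2 ℕ.* h)))
      ℕ.+ (suc (k ℕ.+ suc d) ℕ.+ k) ℕ.* (2 ℕ.* suc k) ℕ.* (y ℕ.* ((suc d ℕ.* f) ℕ.* g ℕ.* h))
  expand = solve-∀
  collect : ∀ d k y →
    suc d ℕ.* ((suc (k ℕ.+ suc d) ℕ.+ k) ℕ.* y) ℕ.+ (suc (k ℕ.+ suc d) ℕ.+ k) ℕ.* (2 ℕ.* suc k) ℕ.* y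
    ≡ suc (suc (k ℕ.+ suc d) ℕ.+ k) ℕ.* ((suc (k ℕ.+ suc d) ℕ.+ k) ℕ.* y)
  collect = solve-∀

besselCoeff≡bessel : ∀ n k → k ≤ n → besselCoeff n k ≡ fromℕ (bessel n k)
besselCoeff≡bessel n k k≤n with ℕP.m≤n⇒∃[o]m+o≡n k≤n
... | d , refl = trans (ℚP./-cong {{nonZero}} {{nonZero}} (cong pos numerator) refl)
                       (fromℕ-/ (bessel (k ℕ.+ d) k) _ {{nonZero}})
  where
  denominator : ℕ
  denominator = (k ℕ.+ d ℕ.∸ k) ! ℕ.* k ! ℕ.* 2 ℕ.^ k
  nonZero : ℕ.NonZero denominator
  nonZero = ℕP.m*n≢0 _ _ {{(k ℕ.+ d ℕ.∸ k) ℕP.!* k !≢0}} {{ℕP.m^n≢0 2 k}}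
  numerator : (k ℕ.+ d ℕ.+ k) ! ≡ bessel (k ℕ.+ d) k ℕ.* denominator
  numerator = trans (sym (bessel-factorial k d))
    (cong (λ m → bessel (k ℕ.+ d) k ℕ.* (m ! ℕ.* k ! ℕ.* 2 ℕ.^ k)) (sym (ℕP.m+n∸m≡n k d)))

pure-D^ : ∀ n → Pure (suc n) (D^ n (A *P B))
pure-D^ zero    = (refl , refl) ∷ []
pure-D^ (suc n) = pure-D (D^ n (A *P B)) (pure-D^ n)

cCoeff-D^ : ∀ n k → cCoeff (D^ n (A *P B)) k ≡ fromℕ (bessel n k)
cCoeff-D^ zero    zero    = refl
cCoeff-D^ zero    (suc k) = refl
cCoeff-D^ (suc n) zero    = trans (cCoeff-D-zero (D^ n (A *P B)) (pure-D^ n)) (cCoeff-D^ n zero)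
cCoeff-D^ (suc n) (suc k) = begin
  cCoeff (D (D^ n (A *P B))) (suc k)
    ≡⟨ cCoeff-D-suc (D^ n (A *P B)) (pure-D^ n) k ⟩
  cCoeff (D^ n (A *P B)) (suc k) + (suc n ℕ.+ k) · cCoeff (D^ n (A *P B)) k
    ≡⟨ cong₂ (λ x y → x + (suc n ℕ.+ k) · y) (cCoeff-D^ n (suc k)) (cCoeff-D^ n k) ⟩
  fromℕ (bessel n (suc k)) + (suc n ℕ.+ k) · fromℕ (bessel n k)
    ≡⟨ cong (fromℕ (bessel n (suc k)) +_) (·-fromℕ (suc n ℕ.+ k) (bessel n k)) ⟩
  fromℕ (bessel n (suc k)) + fromℕ ((suc n ℕ.+ k) ℕ.* bessel n k)
    ≡⟨ sym (fromℕ-+ (bessel n (suc k)) _) ⟩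
  fromℕ (bessel (suc n) (suc k)) ∎

-- The polynomial Σ_{m ∈ L} g(m) c^m; by definition
-- bessel-c n = cSeries (besselCoeff n) (upTo (suc n)).
cSeries : (ℕ → ℚ) → List ℕ → Poly
cSeries g = concatMap (λ m → scale (g m) (mono 0 0 m))

cCoeff-cSeries-snoc : ∀ g M k →
  cCoeff (cSeries g (upTo (suc M))) k ≡ cCoeff (cSeries g (upTo M)) k + δ M k (g M)
cCoeff-cSeries-snoc g M k = begin
  cCoeff (cSeries g (upTo (suc M))) k
    ≡⟨ cong (λ L → cCoeff (cSeries g L) k) (sym (ListP.applyUpTo-∷ʳ (λ m → m) M)) ⟩
  cCoeff (cSeries g (upTo M ++ M ∷ [])) k
    ≡⟨ cong (λ p → cCoeff p k) (ListP.concatMap-++ _ (upTo M) (M ∷ [])) ⟩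
  cCoeff (cSeries g (upTo M) ++ cSeries g (M ∷ [])) k
    ≡⟨ cCoeff-++ (cSeries g (upTo M)) (cSeries g (M ∷ [])) k ⟩
  cCoeff (cSeries g (upTo M)) k + (δ M k (g M * 1ℚ) + 0ℚ)
    ≡⟨ cong (cCoeff (cSeries g (upTo M)) k +_)
            (trans (ℚP.+-identityʳ _) (cong (δ M k) (ℚP.*-identityʳ (g M)))) ⟩
  cCoeff (cSeries g (upTo M)) k + δ M k (g M) ∎

cCoeff-cSeries-out : ∀ g {M k} → M ≤ k → cCoeff (cSeries g (upTo M)) k ≡ 0ℚ
cCoeff-cSeries-out g {zero}  {k} _   = refl
cCoeff-cSeries-out g {suc M} {k} M<k = begin
  cCoeff (cSeries g (upTo (suc M))) k         ≡⟨ cCoeff-cSeries-snoc g M k ⟩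
  cCoeff (cSeries g (upTo M)) k + δ M k (g M) ≡⟨ cong₂ _+_ (cCoeff-cSeries-out g (ℕP.<⇒≤ M<k))
                                                          (δ-≢ M k (g M) (ℕP.<⇒≢ M<k)) ⟩
  0ℚ ∎

cCoeff-cSeries-in : ∀ g {M k} → k < M → cCoeff (cSeries g (upTo M)) k ≡ g k
cCoeff-cSeries-in g {suc M} {k} (s≤s k≤M) with ℕP.m≤n⇒m<n∨m≡n k≤M
... | inj₁ k<M = begin
  cCoeff (cSeries g (upTo (suc M))) k         ≡⟨ cCoeff-cSeries-snoc g M k ⟩
  cCoeff (cSeries g (upTo M)) k + δ M k (g M) ≡⟨ cong₂ _+_ (cCoeff-cSeries-in g k<M)
                                                          (δ-≢ M k (g M) (ℕP.<⇒≢ k<M ∘ sym)) ⟩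
  g k + 0ℚ                                    ≡⟨ ℚP.+-identityʳ (g k) ⟩
  g k ∎
... | inj₂ refl = begin
  cCoeff (cSeries g (upTo (suc M))) M         ≡⟨ cCoeff-cSeries-snoc g M M ⟩
  cCoeff (cSeries g (upTo M)) M + δ M M (g M) ≡⟨ cong₂ _+_ (cCoeff-cSeries-out g (ℕP.≤-refl {M})) (δ-refl M (g M)) ⟩
  0ℚ + g M                                    ≡⟨ ℚP.+-identityˡ (g M) ⟩
  g M ∎

cCoeff-bessel-c : ∀ n k → cCoeff (bessel-c n) k ≡ fromℕ (bessel n k)
cCoeff-bessel-c n k with k ℕ.≤? n
... | yes k≤n = trans (cCoeff-cSeries-in (besselCoeff n) (s≤s k≤n)) (besselCoeff≡bessel n k k≤n)
... | no  k≰n = trans (cCoeff-cSeries-out (besselCoeff n) (ℕP.≰⇒> k≰n))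
                      (cong fromℕ (sym (bessel-vanishes (ℕP.≰⇒> k≰n))))

pure-mulTerm-cSeries : ∀ q J g L → Pure J (map (mulTerm (q , (1 , J , 0))) (cSeries g L))
pure-mulTerm-cSeries q J g []      = []
pure-mulTerm-cSeries q J g (m ∷ L) = (refl , ℕP.+-identityʳ J) ∷ pure-mulTerm-cSeries q J g L

B^P : ∀ m → B ^P m ≡ mono 0 m 0
B^P zero    = refl
B^P (suc m) = cong (B *P_) (B^P m)

rhs-shape : ∀ n → A *P (B ^P suc n) *P bessel-c n ≡ map (mulTerm (1ℚ , (1 , suc n , 0))) (bessel-c n) ++ []
rhs-shape n = cong (λ p → A *P p *P bessel-c n) (B^P (suc n))

pure-rhs : ∀ n → Pure (suc n) (A *P (B ^P suc n) *P bessel-c n)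
pure-rhs n rewrite rhs-shape n =
  ++⁺ (pure-mulTerm-cSeries 1ℚ (suc n) (besselCoeff n) (upTo (suc n))) []

cCoeff-rhs : ∀ n k → cCoeff (A *P (B ^P suc n) *P bessel-c n) k ≡ fromℕ (bessel n k)
cCoeff-rhs n k rewrite rhs-shape n = begin
  cCoeff (map (mulTerm (1ℚ , (1 , suc n , 0))) (bessel-c n) ++ []) k
    ≡⟨ trans (cCoeff-++ (map (mulTerm (1ℚ , (1 , suc n , 0))) (bessel-c n)) [] k) (ℚP.+-identityʳ _) ⟩
  cCoeff (map (mulTerm (1ℚ , (1 , suc n , 0))) (bessel-c n)) k
    ≡⟨ cCoeff-mulTerm 1ℚ 1 (suc n) (bessel-c n) k ⟩
  1ℚ * cCoeff (bessel-c n) k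
    ≡⟨ ℚP.*-identityˡ _ ⟩
  cCoeff (bessel-c n) k
    ≡⟨ cCoeff-bessel-c n k ⟩
  fromℕ (bessel n k) ∎

theorem1 : ∀ (n : ℕ) → D^ n (A *P B) ≈P A *P (B ^P suc n) *P bessel-c n
theorem1 n = pure-≈P (pure-D^ n) (pure-rhs n) λ k → begin
  cCoeff (D^ n (A *P B)) k                        ≡⟨ cCoeff-D^ n k ⟩
  fromℕ (bessel n k)                              ≡⟨ sym (cCoeff-rhs n k) ⟩
  cCoeff (A *P (B ^P suc n) *P bessel-c n) k      ∎
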